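{- For every infinite set $X\subseteq\mathbb{N}$ there is an infinite set $A\subseteq X$ such that $X\not\leq_{fe}A$.
   Context: $\mathbb{N}=\{0,1,2,\dots\}$. For $A,B\subseteq\mathbb{N}$, $A\leq_{fe}B$ means that for every finite $F\subseteq A$ there is $k\in\mathbb{N}$ with $F+k\subseteq B$. -}

module Defs where

open import Level using (0ℓ)
open import Data.Nat using (ℕ; _+_; _≤_)
open import Data.Product using (Σ; _×_)
open import Data.List using (List)
open import Data.List.Relation.Unary.All using (All)
open import Relation.Unary using (Pred)

Subset : Set₁
Subset = Pred ℕ 0ℓ

Infinite : Subset → Set
Infinite X = (n : ℕ) → Σ ℕ (λ m → n ≤ m × X m)

-- A finite subset of A: given by a list of its elements, all in A.
-- A ≤fe B : for every finite F ⊆ A there is k with F + k ⊆ B.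
_≤fe_ : Subset → Subset → Set
A ≤fe B = (F : List ℕ) → All A F → Σ ℕ (λ k → All (λ x → B (x + k)) F)

-- Fix x₀ < x₁ in X and choose A ⊆ X so sparse that any two of its elements
-- differ by more than x₁. Then no translate {x₀ + k, x₁ + k} of the pair
-- {x₀, x₁} ⊆ X fits into A.
module Submission where

open import Defs
open import Data.Nat using (ℕ; zero; suc; _+_; _<_; _≤_; z≤n; s≤s)
open import Data.Nat.Properties
  using (<-cmp; <-irrefl; <-asym; <-trans; <⇒≱; ≤-trans; ≤-reflexive; ≤-<-trans;
         m≤m+n; m≤n+m; m≤n⇒m<n∨m≡n; +-monoˡ-≤; +-monoˡ-<; +-commutativeSemigroup)
open import Algebra.Properties.CommutativeSemigroup +-commutativeSemigroup
  using (xy∙z≈xz∙y)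
open import Data.Empty using (⊥-elim)
open import Data.Product using (Σ; _×_; _,_; proj₁; proj₂)
open import Data.Sum using (inj₁; inj₂)
open import Data.List using ([]; _∷_)
open import Data.List.Relation.Unary.All using ([]; _∷_)
open import Relation.Binary.Definitions using (tri<; tri≈; tri>)
open import Relation.Binary.PropositionalEquality using (_≡_; refl)
open import Relation.Unary using (_⊆_)
open import Relation.Nullary using (¬_)

Sparse : ℕ → Subset → Set
Sparse g A = ∀ {m n} → A m → A n → m < n → m + g < n

Gapped : ℕ → (ℕ → ℕ) → Set
Gapped g a = ∀ i → a i + g < a (suc i)

Image : (ℕ → ℕ) → Subset
Image a m = Σ ℕ λ i → a i ≡ m

module _ {g : ℕ} {a : ℕ → ℕ} (gapped : Gapped g a) where

  gapped-< : ∀ {i j} → i < j → a i + g < a j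
  gapped-< {i} {suc j} (s≤s i≤j) with m≤n⇒m<n∨m≡n i≤j
  ... | inj₁ i<j  = <-trans (gapped-< i<j) (≤-<-trans (m≤m+n (a j) g) (gapped j))
  ... | inj₂ refl = gapped i

  gapped⇒n≤a[n] : ∀ n → n ≤ a n
  gapped⇒n≤a[n] zero    = z≤n
  gapped⇒n≤a[n] (suc n) =
    ≤-<-trans (gapped⇒n≤a[n] n) (≤-<-trans (m≤m+n (a n) g) (gapped n))

  image-infinite : Infinite (Image a)
  image-infinite n = a n , gapped⇒n≤a[n] n , n , refl

  image-sparse : Sparse g (Image a)
  image-sparse (i , refl) (j , refl) aᵢ<aⱼ with <-cmp i j
  ... | tri< i<j _ _  = gapped-< i<j
  ... | tri≈ _ refl _ = ⊥-elim (<-irrefl refl aᵢ<aⱼ)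
  ... | tri> _ _ j<i  = ⊥-elim (<-asym aᵢ<aⱼ (≤-<-trans (m≤m+n _ g) (gapped-< j<i)))

module _ {X : Subset} (X-infinite : Infinite X) (g : ℕ) where

  sparse-sequence : ℕ → ℕ
  sparse-sequence zero    = proj₁ (X-infinite 0)
  sparse-sequence (suc i) = proj₁ (X-infinite (suc (sparse-sequence i + g)))

  sparse-sequence-∈ : ∀ i → X (sparse-sequence i)
  sparse-sequence-∈ zero    = proj₂ (proj₂ (X-infinite 0))
  sparse-sequence-∈ (suc i) = proj₂ (proj₂ (X-infinite (suc (sparse-sequence i + g))))

  sparse-sequence-gapped : Gapped g sparse-sequence
  sparse-sequence-gapped i = proj₁ (proj₂ (X-infinite (suc (sparse-sequence i + g))))

infinite⇒sparse-subset : ∀ {X} → Infinite X → (g : ℕ) →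
                         Σ Subset λ A → A ⊆ X × Infinite A × Sparse g A
infinite⇒sparse-subset X-infinite g =
  Image (sparse-sequence X-infinite g) ,
  (λ { (i , refl) → sparse-sequence-∈ X-infinite g i }) ,
  image-infinite (sparse-sequence-gapped X-infinite g) ,
  image-sparse (sparse-sequence-gapped X-infinite g)

sparse⇒¬translated-pair : ∀ {g A m n} k → Sparse g A → m < n → n ≤ m + g →
                          A (m + k) → ¬ A (n + k)
sparse⇒¬translated-pair {g} {m = m} k sparse m<n n≤m+g Aₘ₊ₖ Aₙ₊ₖ =
  <⇒≱ (sparse Aₘ₊ₖ Aₙ₊ₖ (+-monoˡ-< k m<n))
      (≤-trans (+-monoˡ-≤ k n≤m+g) (≤-reflexive (xy∙z≈xz∙y m g k)))

sparse⇒≰fe : ∀ {g X A m n} → Sparse g A → X m → X n → m < n → n ≤ m + g →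
             ¬ (X ≤fe A)
sparse⇒≰fe sparse Xₘ Xₙ m<n n≤m+g X≤feA with X≤feA (_ ∷ _ ∷ []) (Xₘ ∷ Xₙ ∷ [])
... | k , Aₘ₊ₖ ∷ Aₙ₊ₖ ∷ [] = sparse⇒¬translated-pair k sparse m<n n≤m+g Aₘ₊ₖ Aₙ₊ₖ

corollary9 : (X : Subset) → Infinite X →
    Σ Subset (λ A → A ⊆ X × Infinite A × ¬ (X ≤fe A))
corollary9 X X-infinite =
  let x₀ , _ , Xx₀ = X-infinite 0
      x₁ , x₀<x₁ , Xx₁ = X-infinite (suc x₀)
      A , A⊆X , A-infinite , A-sparse = infinite⇒sparse-subset X-infinite x₁
  in A , A⊆X , A-infinite , sparse⇒≰fe A-sparse Xx₀ Xx₁ x₀<x₁ (m≤n+m x₁ x₀)
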